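{- Let $A$ be an arena, $\sigma : A$ a parallel innocent causal strategy, and $q^+ \in |\sigma|$. If $q <_\sigma m_1^-$ and $q <_\sigma m_2^-$ are immediate causal links (no event strictly in between) with $m_1\neq m_2$, then the sets $\{m \in |\sigma| \mid m \geq_\sigma m_1\}$ and $\{m \in |\sigma| \mid m \geq_\sigma m_2\}$ are disjoint.
   Context: $\sigma : A$ is a causal strategy (event structure with symmetry and locally injective display map $\partial_\sigma$ to the arena, courteous, receptive). A grounded causal chain (gcc) is a chain $\rho_1,\dots,\rho_n$ with $\rho_1$ minimal in $\sigma$ and each $\rho_i <_\sigma \rho_{i+1}$ immediately. $\sigma$ is parallel innocent if it is causally deterministic (every finite set of events whose negative events are pairwise non-conflicting is conflict-free), visible (every gcc displays to a configuration of $A$), and pre-innocent: for $m^+$ and two distinct gccs both extended by an immediate step into $m$, their least distinct events are positive. -}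

module Defs where

open import Data.List using (List; []; _∷_; map; _++_)
open import Data.List.Membership.Propositional using (_∈_; _∉_)
open import Data.List.Relation.Binary.Subset.Propositional using (_⊆_)
open import Data.Product using (Σ; _×_; _,_; ∃; ∃-syntax)
open import Data.Empty using (⊥)
open import Data.Sum using (_⊎_)
open import Relation.Nullary using (¬_)
open import Relation.Binary.PropositionalEquality using (_≡_; _≢_)

data Pol : Set where
  + - : Pol

-- Event structures (Winskel, with a consistency predicate on finite sets;
-- finite sets are represented by lists, and all axioms are stated up to
-- list-membership inclusion, so the predicate is extensional).

record EventStructure : Set₁ where
  field
    E     : Set
    _≤_   : E → E → Set
    Con   : List E → Set
    ≤-refl    : ∀ {e} → e ≤ e
    ≤-trans   : ∀ {e e′ e″} → e ≤ e′ → e′ ≤ e″ → e ≤ e″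
    ≤-antisym : ∀ {e e′} → e ≤ e′ → e′ ≤ e → e ≡ e′
    finite-down : ∀ e → Σ (List E) λ L → ∀ e′ → (e′ ∈ L → e′ ≤ e) × (e′ ≤ e → e′ ∈ L)
    Con-single  : ∀ e → Con (e ∷ [])
    Con-sub     : ∀ {X Y} → Y ⊆ X → Con X → Con Y
    Con-down    : ∀ {X e e′} → Con X → e′ ∈ X → e ≤ e′ → Con (e ∷ X)

  _<_ : E → E → Set
  e < e′ = e ≤ e′ × e ≢ e′

  _⋖_ : E → E → Set
  e ⋖ e′ = e < e′ × (∀ e″ → e < e″ → e″ < e′ → ⊥)

  minimal : E → Set
  minimal e = ∀ e′ → e′ ≤ e → e′ ≡ e

  IsConfig : List E → Set
  IsConfig x = (∀ {e e′} → e ∈ x → e′ ≤ e → e′ ∈ x) × Con x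

  NonConflicting : E → E → Set
  NonConflicting e e′ = Con (e ∷ e′ ∷ [])

record Arena : Set₁ where
  field
    ES  : EventStructure
  open EventStructure ES public
  field
    pol : E → Pol
    alternating : ∀ {a a′} → a ⋖ a′ → pol a ≢ pol a′
    forestial   : ∀ {a a′ a″} → a′ ≤ a → a″ ≤ a → (a′ ≤ a″) ⊎ (a″ ≤ a′)
    race-free   : ∀ {x a b} → IsConfig x → IsConfig (a ∷ x) → IsConfig (b ∷ x)
                  → ¬ IsConfig (a ∷ b ∷ x) → pol a ≡ pol b

module _ (A : Arena) where
  private module A = Arena A

  record Strategy : Set₁ where
    field
      S : EventStructure
    open EventStructure S public
    field
      ∂ : E → A.E
      ∂-config : ∀ {x} → IsConfig x → A.IsConfig (map ∂ x)
      ∂-locinj : ∀ {x} → IsConfig x → ∀ {s s′} → s ∈ x → s′ ∈ x → ∂ s ≡ ∂ s′ → s ≡ s′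

    pol : E → Pol
    pol s = A.pol (∂ s)

    field
      courteous : ∀ {s s′} → s ⋖ s′ → (pol s ≡ + ⊎ pol s′ ≡ -) → ∂ s A.⋖ ∂ s′
      receptive : ∀ {x a} → IsConfig x → A.pol a ≡ - → a ∉ map ∂ x
                  → A.IsConfig (a ∷ map ∂ x)
                  → Σ E λ s → (IsConfig (s ∷ x) × ∂ s ≡ a)
                       × (∀ s′ → IsConfig (s′ ∷ x) → ∂ s′ ≡ a → s′ ≡ s)

module _ {A : Arena} (σ : Strategy A) where
  private module A = Arena A
  open Strategy σ

  data Chain : E → List E → Set where
    [_]  : ∀ e → Chain e (e ∷ [])
    _∷⋖_ : ∀ {e e′ ρ} → e ⋖ e′ → Chain e′ ρ → Chain e (e ∷ ρ)

  data Last : List E → E → Set where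
    last-[] : ∀ e → Last (e ∷ []) e
    last-∷  : ∀ e {e′ ρ l} → Last (e′ ∷ ρ) l → Last (e ∷ e′ ∷ ρ) l

  IsGCC : List E → Set
  IsGCC ρ = Σ E λ e → minimal e × Chain e ρ

  CausallyDeterministic : Set
  CausallyDeterministic =
    ∀ (X : List E) →
      (∀ {e e′} → e ∈ X → e′ ∈ X → pol e ≡ - → pol e′ ≡ - → NonConflicting e e′)
      → Con X

  Visible : Set
  Visible = ∀ ρ → IsGCC ρ → A.IsConfig (map ∂ ρ)

  -- for m⁺ and two distinct gccs ρ, ρ′ each extended by an immediate step
  -- into m, their least distinct events (a in ρ and a′ in ρ′, at the first
  -- position where they differ after a common prefix p) are positive
  PreInnocent : Set
  PreInnocent =
    ∀ {m ρ ρ′ l l′} → pol m ≡ + →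
      IsGCC ρ → Last ρ l → l ⋖ m →
      IsGCC ρ′ → Last ρ′ l′ → l′ ⋖ m →
      ∀ (p : List E) a a′ r r′ → ρ ≡ p ++ (a ∷ r) → ρ′ ≡ p ++ (a′ ∷ r′) → a ≢ a′ →
      pol a ≡ + × pol a′ ≡ +

  record ParallelInnocent : Set where
    field
      deterministic : CausallyDeterministic
      visible       : Visible
      pre-innocent  : PreInnocent

{-# OPTIONS --safe #-}
module Submission where

-- Suppose some event lies above both m₁ and m₂ and take a minimal one, y. As q ⋖ m₁ and q ⋖ m₂, the
-- branches are incomparable, so m₁ < y and m₂ < y and y has immediate predecessors l₁ ≥ m₁ and
-- l₂ ≥ m₂. If y is negative, courtesy makes ∂ l₁ and ∂ l₂ immediate predecessors of ∂ y in the forest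
-- A, so l₁ = l₂ by local injectivity, and l₁ is a smaller common upper bound. If y is positive, a gcc
-- into q extended along m₁ … l₁ and along m₂ … l₂ gives two gccs leading into y whose least distinct
-- events are m₁ and m₂, which pre-innocence forces to be positive, although m₁ is negative.
-- Without decidable equality, minimal and maximal elements of finite sets only exist under ¬¬; this
-- suffices as the goal is ⊥.

open import Defs
open import Data.Empty using (⊥; ⊥-elim)
open import Data.List using (List; []; _∷_; _++_)
open import Data.List.Membership.Propositional using (_∈_)
open import Data.List.Membership.Propositional.Properties using (∈-++⁺ˡ; ∈-++⁺ʳ)
open import Data.List.Relation.Unary.Any using (here; there)
import Data.List.Relation.Unary.All as All
open import Data.Product using (∃-syntax; _×_; _,_; proj₁; proj₂)
open import Data.Sum using (inj₁; inj₂)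
open import Effect.Monad using (RawMonad)
open import Level using (0ℓ)
open import Function using (_∘_; id)
open import Relation.Binary.Definitions using (Transitive)
open import Relation.Binary.PropositionalEquality using (_≡_; _≢_; refl; sym; trans; subst; cong)
open import Relation.Nullary using (¬_; Dec; yes; no)
open import Relation.Nullary.Decidable using (¬¬-excluded-middle)
open import Relation.Nullary.Negation using (¬¬-Monad)

open RawMonad (¬¬-Monad {0ℓ})

+≢- : + ≢ -
+≢- ()

module _ {X : Set} {_≺_ : X → X → Set} (≺-trans : Transitive _≺_) (≺-irrefl : ∀ {x} → ¬ x ≺ x) where

  ¬¬-maximal : (S : X → Set) (L : List X) → ∃[ c ] S c →
               ¬ ¬ (∃[ c ] S c × (∀ {e} → e ∈ L → S e → ¬ c ≺ e))
  ¬¬-maximal S []      (c , Sc) = return (c , Sc , λ ())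
  ¬¬-maximal S (x ∷ L) c₀       = do
    (c , Sc , c-max) ← ¬¬-maximal S L c₀
    extend c Sc c-max <$> ¬¬-excluded-middle
    where
    extend : ∀ c → S c → (∀ {e} → e ∈ L → S e → ¬ c ≺ e) → Dec (S x × c ≺ x) →
             ∃[ c′ ] S c′ × (∀ {e} → e ∈ x ∷ L → S e → ¬ c′ ≺ e)
    extend c Sc c-max (yes (Sx , c≺x)) = x , Sx , λ
      { (here refl) _ → ≺-irrefl
      ; (there e∈L) Se x≺e → c-max e∈L Se (≺-trans c≺x x≺e) }
    extend c Sc c-max (no x-not-above) = c , Sc , λ
      { (here refl) Sx c≺x → x-not-above (Sx , c≺x)
      ; (there e∈L) → c-max e∈L }

module EventStructureProperties (ES : EventStructure) where
  open EventStructure ES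

  history : E → List E
  history e = proj₁ (finite-down e)

  history-≤ : ∀ {e e′} → e′ ∈ history e → e′ ≤ e
  history-≤ {e} {e′} = proj₁ (proj₂ (finite-down e) e′)

  ≤-history : ∀ {e e′} → e′ ≤ e → e′ ∈ history e
  ≤-history {e} {e′} = proj₂ (proj₂ (finite-down e) e′)

  <-trans : Transitive _<_
  <-trans (a≤b , a≢b) (b≤c , b≢c) = ≤-trans a≤b b≤c , λ { refl → b≢c (≤-antisym b≤c a≤b) }

  <-irrefl : ∀ {e} → ¬ e < e
  <-irrefl (_ , e≢e) = e≢e refl

  Con-below : ∀ e (L : List E) → (∀ {e′} → e′ ∈ L → e′ ≤ e) → Con (L ++ e ∷ [])
  Con-below e []      _   = Con-single e
  Con-below e (x ∷ L) L≤e = Con-down (Con-below e L (L≤e ∘ there)) (∈-++⁺ʳ L (here refl)) (L≤e (here refl))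

  history-isConfig : ∀ e → IsConfig (history e)
  history-isConfig e =
    (λ e′∈ e″≤e′ → ≤-history (≤-trans e″≤e′ (history-≤ e′∈))) ,
    Con-sub (λ {x} → ∈-++⁺ˡ {v = x} {xs = history e}) (Con-below e (history e) history-≤)

  ⋖-common-source-incomparable : ∀ {q a b} → q ⋖ a → q ⋖ b → a ≢ b → ¬ a ≤ b
  ⋖-common-source-incomparable q⋖a (_ , nothing-between) a≢b a≤b =
    nothing-between _ (proj₁ q⋖a) (a≤b , a≢b)

  ⋖-common-target-incomparable : ∀ {a b m} → a ⋖ m → b ⋖ m → a ≢ b → ¬ a ≤ b
  ⋖-common-target-incomparable (_ , nothing-between) b⋖m a≢b a≤b =
    nothing-between _ (a≤b , a≢b) (proj₁ b⋖m)

  ⋖-common-source-<-upper-bound : ∀ {q a b y} → q ⋖ a → q ⋖ b → a ≢ b → a ≤ y → b ≤ y → a < y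
  ⋖-common-source-<-upper-bound q⋖a q⋖b a≢b a≤y b≤y =
    a≤y , λ { refl → ⋖-common-source-incomparable q⋖b q⋖a (a≢b ∘ sym) b≤y }

  ¬¬-⋖-factor : ∀ {x m} → x < m → ¬ ¬ (∃[ l ] x ≤ l × l ⋖ m)
  ¬¬-⋖-factor {x} {m} x<m = do
    (l , (x≤l , l<m) , l-max) ←
      ¬¬-maximal <-trans <-irrefl (λ l → x ≤ l × l < m) (history m) (x , ≤-refl , x<m)
    return (l , x≤l , l<m , λ e l<e e<m →
      l-max (≤-history (proj₁ e<m)) (≤-trans x≤l (proj₁ l<e) , e<m) l<e)

  ¬¬-<-minimal : (P : E → Set) → ∀ {y} → P y → ¬ ¬ (∃[ z ] P z × (∀ {w} → w < z → ¬ P w))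
  ¬¬-<-minimal P {y} Py = do
    (z , (z≤y , Pz) , z-min) ←
      ¬¬-maximal (λ b<a c<b → <-trans c<b b<a) <-irrefl (λ z → z ≤ y × P z) (history y) (y , ≤-refl , Py)
    return (z , Pz , λ {w} w<z Pw →
      let w≤y = ≤-trans (proj₁ w<z) z≤y in z-min (≤-history w≤y) (w≤y , Pw) w<z)

  ¬¬-minimal-below : ∀ e → ¬ ¬ (∃[ e₀ ] minimal e₀ × e₀ ≤ e)
  ¬¬-minimal-below e = do
    (e₀ , e₀≤e , e₀-min) ← ¬¬-<-minimal (_≤ e) ≤-refl
    below-e₀-is-e₀ ← All.sequenceM _ ¬¬-Monad (All.tabulate λ e′∈ e′≢e₀ →
      e₀-min (history-≤ e′∈ , e′≢e₀) (≤-trans (history-≤ e′∈) e₀≤e))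
    return (e₀ , (λ e′ e′≤e₀ → All.lookup below-e₀-is-e₀ (≤-history e′≤e₀)) , e₀≤e)

module ArenaProperties (A : Arena) where
  open Arena A
  open EventStructureProperties ES

  ⋖-predecessor-unique : ∀ {a b m} → a ⋖ m → b ⋖ m → ¬ a ≢ b
  ⋖-predecessor-unique a⋖m b⋖m a≢b with forestial (proj₁ (proj₁ a⋖m)) (proj₁ (proj₁ b⋖m))
  ... | inj₁ a≤b = ⋖-common-target-incomparable a⋖m b⋖m a≢b a≤b
  ... | inj₂ b≤a = ⋖-common-target-incomparable b⋖m a⋖m (a≢b ∘ sym) b≤a

module StrategyProperties {A : Arena} (σ : Strategy A) where
  private module A = ArenaProperties A
  open Strategy σ
  open EventStructureProperties S

  ⋖-negative-predecessor-unique : ∀ {l₁ l₂ m} → pol m ≡ - → l₁ ⋖ m → l₂ ⋖ m → ¬ l₁ ≢ l₂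
  ⋖-negative-predecessor-unique {m = m} m⁻ l₁⋖m l₂⋖m l₁≢l₂ =
    A.⋖-predecessor-unique (courteous l₁⋖m (inj₂ m⁻)) (courteous l₂⋖m (inj₂ m⁻))
      (l₁≢l₂ ∘ ∂-locinj (history-isConfig m) (≤-history (proj₁ (proj₁ l₁⋖m)))
                                              (≤-history (proj₁ (proj₁ l₂⋖m))))

  Last-∷ : ∀ {x ρ l} → Last σ ρ l → Last σ (x ∷ ρ) l
  Last-∷ {x} ρ-last@(last-[] _)  = last-∷ x ρ-last
  Last-∷ {x} ρ-last@(last-∷ _ _) = last-∷ x ρ-last

  Last-++ : ∀ g {ρ l} → Last σ ρ l → Last σ (g ++ ρ) l
  Last-++ []      ρ-last = ρ-last
  Last-++ (x ∷ g) ρ-last = Last-∷ (Last-++ g ρ-last)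

  Chain-++ : ∀ {e g q m ρ} → Chain σ e g → Last σ g q → q ⋖ m → Chain σ m ρ → Chain σ e (g ++ ρ)
  Chain-++ [ _ ]             (last-[] _)       q⋖m ρ-chain = q⋖m ∷⋖ ρ-chain
  Chain-++ (e⋖e′ ∷⋖ g-chain) (last-∷ _ g-last) q⋖m ρ-chain = e⋖e′ ∷⋖ Chain-++ g-chain g-last q⋖m ρ-chain

  Chain-head : ∀ {e ρ} → Chain σ e ρ → ∃[ r ] ρ ≡ e ∷ r
  Chain-head [ _ ]              = [] , refl
  Chain-head (_∷⋖_ {ρ = ρ} _ _) = ρ , refl

  IsGCC-++ : ∀ {g q m ρ} → IsGCC σ g → Last σ g q → q ⋖ m → Chain σ m ρ → IsGCC σ (g ++ ρ)
  IsGCC-++ (e₀ , e₀-min , g-chain) g-last q⋖m ρ-chain = e₀ , e₀-min , Chain-++ g-chain g-last q⋖m ρ-chain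

  ¬¬-Chain : ∀ {x y} → x ≤ y → ¬ ¬ (∃[ ρ ] Chain σ x ρ × Last σ ρ y)
  ¬¬-Chain {x} x≤y no-chain = ¬¬-<-minimal Unreachable (x≤y , no-chain) no-minimal-unreachable
    where
    Unreachable : E → Set
    Unreachable z = x ≤ z × ¬ (∃[ ρ ] Chain σ x ρ × Last σ ρ z)

    no-minimal-unreachable : ¬ (∃[ z ] Unreachable z × (∀ {w} → w < z → ¬ Unreachable w))
    no-minimal-unreachable (z , (x≤z , no-chain-z) , z-min) = ¬¬-excluded-middle {A = x ≡ z} λ
      { (yes refl) → no-chain-z (x ∷ [] , [ x ] , last-[] x)
      ; (no x≢z) → ¬¬-⋖-factor (x≤z , x≢z) λ (l , x≤l , l⋖z) →
          z-min (proj₁ l⋖z) (x≤l , λ (ρ , ρ-chain , ρ-last) →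
            no-chain-z (ρ ++ z ∷ [] , Chain-++ ρ-chain ρ-last l⋖z [ z ] , Last-++ ρ (last-[] z))) }

  ¬¬-gcc : ∀ q → ¬ ¬ (∃[ g ] IsGCC σ g × Last σ g q)
  ¬¬-gcc q = do
    (e₀ , e₀-min , e₀≤q) ← ¬¬-minimal-below q
    (g , g-chain , g-last) ← ¬¬-Chain e₀≤q
    return (g , (e₀ , e₀-min , g-chain) , g-last)

module _ {A : Arena} {σ : Strategy A} (pre-innocent : PreInnocent σ) where
  open Strategy σ
  open StrategyProperties σ

  pre-innocent-branches-positive : ∀ {q m₁ m₂ l₁ l₂ y} → q ⋖ m₁ → q ⋖ m₂ → m₁ ≢ m₂ → pol y ≡ + →
    m₁ ≤ l₁ → l₁ ⋖ y → m₂ ≤ l₂ → l₂ ⋖ y → ¬ ¬ (pol m₁ ≡ + × pol m₂ ≡ +)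
  pre-innocent-branches-positive {q} q⋖m₁ q⋖m₂ m₁≢m₂ y⁺ m₁≤l₁ l₁⋖y m₂≤l₂ l₂⋖y = do
    (g , g-gcc , g-last) ← ¬¬-gcc q
    (ρ₁ , ρ₁-chain , ρ₁-last) ← ¬¬-Chain m₁≤l₁
    (ρ₂ , ρ₂-chain , ρ₂-last) ← ¬¬-Chain m₂≤l₂
    let (r₁ , ρ₁≡m₁∷r₁) = Chain-head ρ₁-chain
        (r₂ , ρ₂≡m₂∷r₂) = Chain-head ρ₂-chain
    return (pre-innocent y⁺
      (IsGCC-++ g-gcc g-last q⋖m₁ ρ₁-chain) (Last-++ g ρ₁-last) l₁⋖y
      (IsGCC-++ g-gcc g-last q⋖m₂ ρ₂-chain) (Last-++ g ρ₂-last) l₂⋖y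
      g _ _ r₁ r₂ (cong (g ++_) ρ₁≡m₁∷r₁) (cong (g ++_) ρ₂≡m₂∷r₂) m₁≢m₂)

  branch-predecessors-coincide : ∀ {q m₁ m₂ l₁ l₂ y} → pol m₁ ≡ - → q ⋖ m₁ → q ⋖ m₂ → m₁ ≢ m₂ →
    m₁ ≤ l₁ → l₁ ⋖ y → m₂ ≤ l₂ → l₂ ⋖ y → ¬ ¬ (l₁ ≡ l₂)
  branch-predecessors-coincide {y = y} m₁⁻ q⋖m₁ q⋖m₂ m₁≢m₂ m₁≤l₁ l₁⋖y m₂≤l₂ l₂⋖y with pol y in y-pol
  ... | - = ⋖-negative-predecessor-unique y-pol l₁⋖y l₂⋖y
  ... | + = do
    (m₁⁺ , _) ← pre-innocent-branches-positive q⋖m₁ q⋖m₂ m₁≢m₂ y-pol m₁≤l₁ l₁⋖y m₂≤l₂ l₂⋖y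
    ⊥-elim (+≢- (trans (sym m₁⁺) m₁⁻))

lemma7p12 : (A : Arena) (σ : Strategy A) → ParallelInnocent σ →
    let open Strategy σ in
    ∀ {q m₁ m₂} → pol q ≡ + → pol m₁ ≡ - → pol m₂ ≡ - →
    q ⋖ m₁ → q ⋖ m₂ → m₁ ≢ m₂ →
    ∀ m → m₁ ≤ m → m₂ ≤ m → ⊥
lemma7p12 A σ PI {_} {m₁} {m₂} _ m₁⁻ _ q⋖m₁ q⋖m₂ m₁≢m₂ m m₁≤m m₂≤m = no-common-bound id
  where
  open Strategy σ
  open EventStructureProperties S
  open ParallelInnocent PI

  no-common-bound : ¬ ¬ ⊥
  no-common-bound = do
    (y , (m₁≤y , m₂≤y) , y-min) ← ¬¬-<-minimal (λ y → m₁ ≤ y × m₂ ≤ y) (m₁≤m , m₂≤m)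
    (l₁ , m₁≤l₁ , l₁⋖y) ← ¬¬-⋖-factor (⋖-common-source-<-upper-bound q⋖m₁ q⋖m₂ m₁≢m₂ m₁≤y m₂≤y)
    (l₂ , m₂≤l₂ , l₂⋖y) ← ¬¬-⋖-factor (⋖-common-source-<-upper-bound q⋖m₂ q⋖m₁ (m₁≢m₂ ∘ sym) m₂≤y m₁≤y)
    l₁≡l₂ ← branch-predecessors-coincide pre-innocent m₁⁻ q⋖m₁ q⋖m₂ m₁≢m₂ m₁≤l₁ l₁⋖y m₂≤l₂ l₂⋖y
    ⊥-elim (y-min (proj₁ l₁⋖y) (m₁≤l₁ , subst (m₂ ≤_) (sym l₁≡l₂) m₂≤l₂))
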